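{- Let $f\colon\{0,1,2\}^*\to\{0,1,2\}^*$ be the morphism $0\mapsto012$, $1\mapsto112002$, $2\mapsto\varepsilon$. Then the constant of recognizability of $f$ on $\mathsf{X}(f)$ equals $2$.
   Context: Let $A=\{0,1,2\}$. The shift $S$ on $A^{\mathbb{Z}}$ is $(z_m)\mapsto(z_{m+1})$. $\mathsf{X}(f)$ is the set of $\mathbf{z}\in A^{\mathbb{Z}}$ all of whose factors are factors of some $f^m(b)$, $m\ge0$, $b\in A$. For $\mathbf{z}\in A^{\mathbb{Z}}$, $f(\mathbf{z})=\cdots f(z_{ -2})f(z_{ -1})\cdot f(z_0)f(z_1)\cdots$ with $f(z_0)$ starting at index $0$. Let $X=\mathsf{X}(f)$ and let $Y$ be the closure under the shift of $f(X)$; $\mathcal{L}_m(Y)$ is the set of length-$m$ factors of elements of $Y$. For words $u,v$ with $uv$ a factor of $Y$, $[u\cdot v]_Y=\{\mathbf{z}\in Y\colon z_{[-|u|,|v|-1]}=uv\}$ and $[b]_X=\{\mathbf{z}\in X\colon z_0=b\}$. The pair $(u,v)$ is synchronizing if there is at most one pair $(b,j)$ with $b\in A$, $0\le j<|f(b)|$, such that $[u\cdot v]_Y\cap S^{j}f([b]_X)\neq\emptyset$. $f$ is recognizable on $X$ with constant $n$ if every pair $(u,v)\in\mathcal{L}_n(Y)\times\mathcal{L}_{n+1}(Y)$ with $uv$ a factor of $Y$ is synchronizing; the constant of recognizability is the least such $n$. -}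

module Defs where

open import Data.Nat using (ℕ; zero; suc; _<_; _≤_)
open import Data.Fin using (Fin; toℕ) renaming (zero to f0; suc to fs)
open import Data.Integer using (ℤ; +_; -_; _+_; ∣_∣)
open import Data.List using (List; []; _∷_; _++_; length; lookup; concatMap)
open import Data.Product using (Σ; ∃; ∃-syntax; _×_; _,_)
open import Relation.Binary.PropositionalEquality using (_≡_)

A : Set
A = Fin 3

a0 a1 a2 : A
a0 = f0
a1 = fs f0
a2 = fs (fs f0)

fmor : A → List A
fmor f0 = a0 ∷ a1 ∷ a2 ∷ []
fmor (fs f0) = a1 ∷ a1 ∷ a2 ∷ a0 ∷ a0 ∷ a2 ∷ []
fmor (fs (fs f0)) = []

fword : List A → List A
fword = concatMap fmor

fpow : ℕ → List A → List A
fpow zero w = w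
fpow (suc m) w = fword (fpow m w)

Factor : List A → List A → Set
Factor w u = ∃[ p ] ∃[ s ] (p ++ w ++ s ≡ u)

InLang : List A → Set
InLang w = ∃[ m ] ∃[ b ] Factor w (fpow m (b ∷ []))

Seq : Set
Seq = ℤ → A

Occurs : Seq → ℤ → List A → Set
Occurs z p w = (i : Fin (length w)) → z (p + + toℕ i) ≡ lookup w i

InX : Seq → Set
InX z = (p : ℤ) (w : List A) → Occurs z p w → InLang w

-- y = f(x): y is the concatenation ⋯ f(x_{-1}) · f(x_0) f(x_1) ⋯ with
-- f(x_0) starting at index 0.  pos k is the starting index of f(x_k).
ImageOf : Seq → Seq → Set
ImageOf x y =
  Σ (ℤ → ℤ) λ pos →
    (pos (+ 0) ≡ + 0)
    × ((k : ℤ) → pos (k + + 1) ≡ pos k + + length (fmor (x k)))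
    × ((k : ℤ) → Occurs y (pos k) (fmor (x k)))

-- Y = closure (in the product topology) of the shift orbit of f(X):
-- every central window of z agrees with a window of some S^k f(x), x ∈ X.
InY : Seq → Set
InY z = (N : ℕ) → ∃[ x ] ∃[ y ] ∃[ k ]
  (InX x × ImageOf x y × ((i : ℤ) → ∣ i ∣ ≤ N → z i ≡ y (i + k)))

FactorOfY : List A → Set
FactorOfY w = ∃[ z ] ∃[ p ] (InY z × Occurs z p w)

InCyl : List A → List A → Seq → Set
InCyl u v z = InY z × Occurs z (- (+ length u)) (u ++ v)

-- [u · v]_Y ∩ S^j f([b]_X) ≠ ∅
Hits : List A → List A → A → ℕ → Set
Hits u v b j = ∃[ z ] (InCyl u v z × ∃[ x ] ∃[ y ]
  (InX x × x (+ 0) ≡ b × ImageOf x y × ((i : ℤ) → z i ≡ y (i + + j))))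

Synchronizing : List A → List A → Set
Synchronizing u v = (b b' : A) (j j' : ℕ) →
  j < length (fmor b) → j' < length (fmor b') →
  Hits u v b j → Hits u v b' j' → (b ≡ b') × (j ≡ j')

Recognizable : ℕ → Set
Recognizable n = (u v : List A) → length u ≡ n → length v ≡ suc n →
  FactorOfY u → FactorOfY v → FactorOfY (u ++ v) → Synchronizing u v

{-# OPTIONS --safe #-}

-- For n = 2 recognizability is a finite check: a point of [u · v]_Y ∩ S^j f([b]_X) shows f(b),
-- starting j letters left of the centre, under the window uv, and any two distinct cuts (b , j)
-- already put different letters under some position of a window of length 5.
-- For n ≤ 1 one needs genuine points of X. As g = f² satisfies g(12) = ⋯12 and g(β) = β⋯ for
-- β = 1 and β = g(0), the words g^k(12) · g^k(β) are nested, lie in the language of f, and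
-- converge to points x ∈ X; their images f(x) are limits of the nested words f(g^k(12) · g^k(β)).
-- The points with x₀ = 1 and x₀x₁ = 00 then give two different cuts reading the same window 1·20.
module Submission where

open import Defs
open import Data.Nat
  using (ℕ; _<_; zero; suc; _+_; _∸_; _≤_; _≤′_; z≤n; s≤s; s≤s⁻¹; ≤′-refl; ≤′-step)
open import Data.Nat.Properties
  using (≤-refl; ≤-trans; ≤-<-trans; <-≤-trans; ≤-total; ≤⇒≤′; n≮0; m≤m+n; m≤n+m; m<m+n;
         +-comm; +-assoc; +-mono-≤; +-monoˡ-<; +-monoʳ-<; +-monoʳ-≤; m∸n≤m; m+n∸n≡m)
import Data.Nat.Properties as ℕₚ
open import Data.Integer as ℤ using (ℤ; +_; -[1+_]; -_; ∣_∣; _⊖_)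
import Data.Integer.Properties as ℤₚ
open import Data.Integer.Properties
  using (-m+n≡n⊖m; pos-+; ⊖-≥; +-cancelˡ-⊖; n⊖n≡0; distribˡ-⊖-+-pos; ∣i+j∣≤∣i∣+∣j∣;
         +-commutativeSemigroup)
open import Algebra.Properties.CommutativeSemigroup +-commutativeSemigroup
  using (x∙yz≈y∙xz; xy∙z≈xz∙y)
open import Data.Fin using (Fin; toℕ; fromℕ<) renaming (zero to f0; suc to fs)
import Data.Fin as Fin
open import Data.Fin.Properties using (toℕ<n; toℕ-fromℕ<; all?)
open import Data.List using (List; []; _∷_; _++_; length; lookup; take; drop)
open import Data.List.Properties
  using (length-++; length-++-≤ˡ; ++-assoc; ++-identityʳ; concatMap-++; take-all; take++drop≡id)
open import Data.Product using (_×_; ∃-syntax; _,_; proj₁; proj₂)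
open import Data.Sum using (inj₁; inj₂)
open import Data.Empty using (⊥-elim)
open import Function using (_∘_; _$_; case_of_)
open import Relation.Nullary using (¬_)
open import Relation.Nullary.Decidable using (Dec; toWitness; _→-dec_; _×-dec_)
open import Relation.Binary.PropositionalEquality
open ≡-Reasoning

-- Total indexing; the junk value a0 is never read outside a word.
nth : List A → ℕ → A
nth []      _       = a0
nth (c ∷ w) zero    = c
nth (c ∷ w) (suc t) = nth w t

nth-++ˡ : ∀ u v {t} → t < length u → nth (u ++ v) t ≡ nth u t
nth-++ˡ (c ∷ u) v {zero}  _   = refl
nth-++ˡ (c ∷ u) v {suc t} t<u = nth-++ˡ u v (s≤s⁻¹ t<u)

nth-++ʳ : ∀ u v t → nth (u ++ v) (length u + t) ≡ nth v t
nth-++ʳ []      v t = refl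
nth-++ʳ (c ∷ u) v t = nth-++ʳ u v t

nth-toℕ : ∀ w (i : Fin (length w)) → nth w (toℕ i) ≡ lookup w i
nth-toℕ (c ∷ w) f0     = refl
nth-toℕ (c ∷ w) (fs i) = nth-toℕ w i

take-++ˡ : ∀ (u v : List A) {t} → t ≤ length u → take t (u ++ v) ≡ take t u
take-++ˡ u       v {zero}  _   = refl
take-++ˡ (c ∷ u) v {suc t} t≤u = cong (c ∷_) (take-++ˡ u v (s≤s⁻¹ t≤u))

take-++ʳ : ∀ (u v : List A) t → take (length u + t) (u ++ v) ≡ u ++ take t v
take-++ʳ []      v t = refl
take-++ʳ (c ∷ u) v t = cong (c ∷_) (take-++ʳ u v t)

take-suc-nth : ∀ w {t} → t < length w → take (suc t) w ≡ take t w ++ nth w t ∷ []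
take-suc-nth (c ∷ w) {zero}  _   = refl
take-suc-nth (c ∷ w) {suc t} t<w = cong (c ∷_) (take-suc-nth w (s≤s⁻¹ t<w))

factor-trans : ∀ {w u v} → Factor w u → Factor u v → Factor w v
factor-trans {w} (p , s , refl) (p′ , s′ , refl) = p′ ++ p , s ++ s′ , (begin
  (p′ ++ p) ++ w ++ s ++ s′   ≡⟨ ++-assoc p′ p _ ⟩
  p′ ++ p ++ w ++ s ++ s′     ≡⟨ cong (λ r → p′ ++ p ++ r) (++-assoc w s s′) ⟨
  p′ ++ p ++ (w ++ s) ++ s′   ≡⟨ cong (p′ ++_) (++-assoc p (w ++ s) s′) ⟨
  p′ ++ (p ++ w ++ s) ++ s′   ∎)

ReadsAt : List A → ℕ → List A → Set
ReadsAt d t w = (i : Fin (length w)) → t + toℕ i < length d × nth d (t + toℕ i) ≡ lookup w i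

readsAt-prefix : ∀ d w → ReadsAt d 0 w → ∃[ s ] w ++ s ≡ d
readsAt-prefix d       []      _ = d , refl
readsAt-prefix []      (c ∷ w) r = ⊥-elim (n≮0 (proj₁ (r f0)))
readsAt-prefix (e ∷ d) (c ∷ w) r =
  let s , w++s≡d = readsAt-prefix d w (λ i → s≤s⁻¹ (proj₁ (r (fs i))) , proj₂ (r (fs i)))
  in  s , cong₂ _∷_ (sym (proj₂ (r f0))) w++s≡d

readsAt-factor : ∀ d t w → ReadsAt d t w → Factor w d
readsAt-factor d       zero    w       r = [] , readsAt-prefix d w r
readsAt-factor d       (suc t) []      r = [] , d , refl
readsAt-factor []      (suc t) (c ∷ w) r = ⊥-elim (n≮0 (proj₁ (r f0)))
readsAt-factor (e ∷ d) (suc t) w       r =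
  let p , s , eq = readsAt-factor d t w (λ i → s≤s⁻¹ (proj₁ (r i)) , proj₂ (r i))
  in  e ∷ p , s , cong (e ∷_) eq

-- The morphism and its language

fword-++ : ∀ u v → fword (u ++ v) ≡ fword u ++ fword v
fword-++ = concatMap-++ fmor

length-fword-++ : ∀ u v → length (fword (u ++ v)) ≡ length (fword u) + length (fword v)
length-fword-++ u v = trans (cong length (fword-++ u v)) (length-++ (fword u))

length-fword-[_] : ∀ c → length (fword (c ∷ [])) ≡ length (fmor c)
length-fword-[ c ] = cong length (++-identityʳ (fmor c))

fword-factor : ∀ {w u} → Factor w u → Factor (fword w) (fword u)
fword-factor {w} (p , s , refl) = fword p , fword s ,
  sym (trans (fword-++ p _) (cong (fword p ++_) (fword-++ w s)))

inLang-fword : ∀ {w} → InLang w → InLang (fword w)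
inLang-fword (m , b , w⊑fᵐb) = suc m , b , fword-factor w⊑fᵐb

inLang-factor : ∀ {w u} → Factor w u → InLang u → InLang w
inLang-factor w⊑u (m , b , u⊑fᵐb) = m , b , factor-trans w⊑u u⊑fᵐb

-- f(d) is the concatenation of the blocks f(d_t); the block of d_t starts at offset d t.
offset : List A → ℕ → ℕ
offset d t = length (fword (take t d))

offset-suc : ∀ d {t} → t < length d → offset d (suc t) ≡ offset d t + length (fmor (nth d t))
offset-suc d {t} t<d = begin
  length (fword (take (suc t) d))                        ≡⟨ cong (length ∘ fword) (take-suc-nth d t<d) ⟩
  length (fword (take t d ++ nth d t ∷ []))              ≡⟨ length-fword-++ (take t d) _ ⟩
  offset d t + length (fword (nth d t ∷ []))             ≡⟨ cong (_+_ (offset d t)) length-fword-[ nth d t ] ⟩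
  offset d t + length (fmor (nth d t))                   ∎

offset-++ : ∀ p d q {t} → t ≤ length d → offset (p ++ d ++ q) (length p + t) ≡ length (fword p) + offset d t
offset-++ p d q {t} t≤d = begin
  length (fword (take (length p + t) (p ++ d ++ q)))     ≡⟨ cong (length ∘ fword) (take-++ʳ p _ t) ⟩
  length (fword (p ++ take t (d ++ q)))                  ≡⟨ cong (length ∘ fword ∘ (p ++_)) (take-++ˡ d q t≤d) ⟩
  length (fword (p ++ take t d))                         ≡⟨ length-fword-++ p _ ⟩
  length (fword p) + offset d t                          ∎

offset-length : ∀ u v → offset (u ++ v) (length u) ≡ length (fword u)
offset-length u v = cong (length ∘ fword) (trans (take-++ˡ u v ≤-refl) (take-all (length u) u ≤-refl))

nth-fword : ∀ d {t} → t < length d → ∀ {i} → i < length (fmor (nth d t)) →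
  offset d t + i < length (fword d) × nth (fword d) (offset d t + i) ≡ nth (fmor (nth d t)) i
nth-fword (c ∷ d) {zero} _ {i} i<fc =
  <-≤-trans i<fc (subst (length (fmor c) ≤_) (sym (length-++ (fmor c))) (m≤m+n _ _)) ,
  nth-++ˡ (fmor c) (fword d) i<fc
nth-fword (c ∷ d) {suc t} t<d {i} i<fc =
  let lt , eq = nth-fword d (s≤s⁻¹ t<d) i<fc in
  subst₂ _<_ (sym shift) (sym (length-++ (fmor c))) (+-monoʳ-< (length (fmor c)) lt) ,
  trans (cong (nth (fword (c ∷ d))) shift) (trans (nth-++ʳ (fmor c) (fword d) _) eq)
  where
  shift : offset (c ∷ d) (suc t) + i ≡ length (fmor c) + (offset d t + i)
  shift = trans (cong (_+ i) (length-++ (fmor c))) (+-assoc (length (fmor c)) (offset d t) i)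

-- Nested families of words and their bi-infinite limits

pos-+-shift : ∀ {t j l} i → + t ≡ j ℤ.+ l → + (t + i) ≡ (j ℤ.+ + i) ℤ.+ l
pos-+-shift {t} {j} {l} i e = begin
  + (t + i)              ≡⟨ pos-+ t i ⟩
  + t ℤ.+ + i            ≡⟨ cong (ℤ._+ + i) e ⟩
  j ℤ.+ l ℤ.+ + i        ≡⟨ xy∙z≈xz∙y j l (+ i) ⟩
  j ℤ.+ + i ℤ.+ l        ∎

m+n⊖n≡m : ∀ m n → (m + n) ⊖ n ≡ + m
m+n⊖n≡m m n = trans (⊖-≥ (m≤n+m n m)) (cong +_ (m+n∸n≡m m n))

m⊖n+n≡m : ∀ m n → m ⊖ n ℤ.+ + n ≡ + m
m⊖n+n≡m m n = trans (distribˡ-⊖-+-pos n m n) (m+n⊖n≡m m n)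

record NestedFamily : Set where
  field
    left right  : ℕ → List A
    left-grows  : ∀ k → ∃[ p ] left (suc k) ≡ p ++ left k
    right-grows : ∀ k → ∃[ q ] right (suc k) ≡ right k ++ q
    left-long   : ∀ k → k ≤ length (left k)
    right-long  : ∀ k → k < length (right k)

module Limit (F : NestedFamily) where
  open NestedFamily F

  word : ℕ → List A
  word k = left k ++ right k

  Extends : ℕ → ℕ → Set
  Extends k k′ = ∃[ p ] ∃[ q ] left k′ ≡ p ++ left k × right k′ ≡ right k ++ q

  extends-≤′ : ∀ {k k′} → k ≤′ k′ → Extends k k′
  extends-≤′ ≤′-refl = [] , [] , refl , sym (++-identityʳ _)
  extends-≤′ {k} {suc k′} (≤′-step k≤k′) =
    let p , q , eˡ , eʳ = extends-≤′ k≤k′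
        p′ , eˡ′ = left-grows k′
        q′ , eʳ′ = right-grows k′
    in  p′ ++ p , q ++ q′ ,
        trans eˡ′ (trans (cong (p′ ++_) eˡ) (sym (++-assoc p′ p (left k)))) ,
        trans eʳ′ (trans (cong (_++ q′) eʳ) (++-assoc (right k) q q′))

  extends-≤ : ∀ {k k′} → k ≤ k′ → Extends k k′
  extends-≤ = extends-≤′ ∘ ≤⇒≤′

  word-extends : ∀ {k k′} ((p , q , _) : Extends k k′) → word k′ ≡ p ++ word k ++ q
  word-extends {k} (p , q , eˡ , eʳ) = begin
    word _                           ≡⟨ cong₂ _++_ eˡ eʳ ⟩
    (p ++ left k) ++ right k ++ q    ≡⟨ ++-assoc p (left k) _ ⟩
    p ++ left k ++ right k ++ q      ≡⟨ cong (p ++_) (++-assoc (left k) (right k) q) ⟨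
    p ++ word k ++ q                 ∎

  length-word-extends : ∀ {k k′} ((p , q , _) : Extends k k′) →
    length (word k′) ≡ length p + (length (word k) + length q)
  length-word-extends e@(p , _) = begin
    length (word _)                          ≡⟨ cong length (word-extends e) ⟩
    length (p ++ _)                          ≡⟨ length-++ p ⟩
    length p + length (word _ ++ _)          ≡⟨ cong (_+_ (length p)) (length-++ (word _)) ⟩
    _                                        ∎

  -- Position j of the limit is read at index t of word k, the centre lying right after left k.
  record Covers (j : ℤ) (k t : ℕ) : Set where
    constructor covering
    field
      centred : + t ≡ j ℤ.+ + length (left k)
      inside  : t < length (word k)
  open Covers

  index : ℤ → ℕ → ℕ
  index j k = ∣ j ℤ.+ + length (left k) ∣

  covers⇒index : ∀ {j k t} → Covers j k t → t ≡ index j k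
  covers⇒index c = cong ∣_∣ (centred c)

  index-covers : ∀ {j k} → ∣ j ∣ ≤ k → Covers j k (index j k)
  index-covers {+ n} {k} n≤k = covering refl $
    subst (n + length (left k) <_) (trans (+-comm (length (right k)) _) (sym (length-++ (left k))))
      (+-monoˡ-< (length (left k)) (≤-<-trans n≤k (right-long k)))
  index-covers { -[1+ n ]} {k} n<k = covering (trans (cong (+_ ∘ ∣_∣) j+l≡) (sym j+l≡)) $
    subst (_< length (word k)) (cong ∣_∣ (sym j+l≡))
      (≤-<-trans (m∸n≤m l (suc n))
        (subst (l <_) (sym (length-++ (left k))) (m<m+n l (≤-<-trans z≤n (right-long k)))))
    where
    l = length (left k)
    j+l≡ : -[1+ n ] ℤ.+ + l ≡ + (l ∸ suc n)
    j+l≡ = ⊖-≥ (≤-trans n<k (left-long k))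

  covers : ∀ {j k t} → ∣ j ∣ ≤ k → + t ≡ j ℤ.+ + length (left k) → Covers j k t
  covers {j} {k} j≤k e =
    covering e (subst (_< length (word k)) (sym (cong ∣_∣ e)) (inside (index-covers {j} j≤k)))

  covers-+ : ∀ {j k t} i → Covers j k t → ∣ j ℤ.+ + i ∣ ≤ k → Covers (j ℤ.+ + i) k (t + i)
  covers-+ {j} i c j+i≤k = covers j+i≤k (pos-+-shift {j = j} i (centred c))

  same-index : ∀ {j k t t′} → Covers j k t → Covers j k t′ → t ≡ t′
  same-index c c′ = trans (covers⇒index c) (sym (covers⇒index c′))

  covers-self : ∀ j → Covers j ∣ j ∣ (index j ∣ j ∣)
  covers-self j = index-covers {j} ≤-refl

  covers-extends : ∀ {j k k′ t} → Covers j k t → ((p , _) : Extends k k′) → Covers j k′ (length p + t)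
  covers-extends {j} {k} {k′} {t} (covering e t<w) ext@(p , q , eˡ , _) = covering eq $
    subst (length p + t <_) (sym (length-word-extends ext))
      (+-monoʳ-< (length p) (<-≤-trans t<w (m≤m+n _ (length q))))
    where
    eq : + (length p + t) ≡ j ℤ.+ + length (left k′)
    eq = begin
      + (length p + t)                          ≡⟨ pos-+ (length p) t ⟩
      + length p ℤ.+ + t                        ≡⟨ cong (ℤ._+_ (+ length p)) e ⟩
      + length p ℤ.+ (j ℤ.+ + length (left k))  ≡⟨ x∙yz≈y∙xz (+ length p) j _ ⟩
      j ℤ.+ (+ length p ℤ.+ + length (left k))  ≡⟨ cong (ℤ._+_ j) (pos-+ (length p) _) ⟨
      j ℤ.+ + (length p + length (left k))      ≡⟨ cong (λ n → j ℤ.+ + n) (length-++ p) ⟨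
      j ℤ.+ + length (p ++ left k)              ≡⟨ cong (λ w → j ℤ.+ + length w) eˡ ⟨
      j ℤ.+ + length (left k′)                  ∎

  Stable : {B : Set} → (ℕ → ℕ → B) → Set
  Stable ψ = ∀ {k k′ t} ((p , _) : Extends k k′) → t < length (word k) → ψ k′ (length p + t) ≡ ψ k t

  limitOf : {B : Set} → (ℕ → ℕ → B) → ℤ → B
  limitOf ψ j = ψ ∣ j ∣ (index j ∣ j ∣)

  limitOf-covers : ∀ {B} {ψ : ℕ → ℕ → B} → Stable ψ → ∀ {j k t} → Covers j k t → limitOf ψ j ≡ ψ k t
  limitOf-covers {ψ = ψ} stable {j} {k} c with ≤-total ∣ j ∣ k
  ... | inj₁ j≤k = let e = extends-≤ j≤k in
    trans (sym (stable e (inside (covers-self j)))) (cong (ψ k) (same-index (covers-extends (covers-self j) e) c))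
  ... | inj₂ k≤j = let e = extends-≤ k≤j in
    trans (cong (ψ ∣ j ∣) (same-index (covers-self j) (covers-extends c e))) (stable e (inside c))

  limit : ℤ → A
  limit = limitOf (λ k → nth (word k))

  nth-stable : Stable (λ k → nth (word k))
  nth-stable {k} {t = t} e@(p , q , _) t<w = begin
    nth (word _) (length p + t)             ≡⟨ cong (λ w → nth w (length p + t)) (word-extends e) ⟩
    nth (p ++ word k ++ q) (length p + t)   ≡⟨ nth-++ʳ p _ t ⟩
    nth (word k ++ q) t                     ≡⟨ nth-++ˡ (word k) q t<w ⟩
    nth (word k) t                          ∎

  limit-covers : ∀ {j k t} → Covers j k t → limit j ≡ nth (word k) t
  limit-covers = limitOf-covers nth-stable

  limit-inX : (∀ k → InLang (word k)) → InX limit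
  limit-inX inLang p w occ = inLang-factor (readsAt-factor (word k) (index p k) w reads) (inLang k)
    where
    k = ∣ p ∣ + length w
    reads : ReadsAt (word k) (index p k) w
    reads i = inside cᵢ , trans (sym (limit-covers cᵢ)) (occ i)
      where
      cᵢ : Covers (p ℤ.+ + toℕ i) k (index p k + toℕ i)
      cᵢ = covers-+ (toℕ i) (index-covers {p} {k} (m≤m+n _ _))
             (≤-trans (∣i+j∣≤∣i∣+∣j∣ p (+ toℕ i)) (+-monoʳ-≤ ∣ p ∣ (ℕₚ.<⇒≤ (toℕ<n i))))

imageFamily : (F : NestedFamily) → let open NestedFamily F in
  (∀ k → k ≤ length (fword (left k))) → (∀ k → k < length (fword (right k))) → NestedFamily
imageFamily F fleft-long fright-long = record
  { left        = fword ∘ left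
  ; right       = fword ∘ right
  ; left-grows  = λ k → let p , e = left-grows k in fword p , trans (cong fword e) (fword-++ p (left k))
  ; right-grows = λ k → let q , e = right-grows k in fword q , trans (cong fword e) (fword-++ (right k) q)
  ; left-long   = fleft-long
  ; right-long  = fright-long
  }
  where open NestedFamily F

module Image (F : NestedFamily)
             (fleft-long : ∀ k → k ≤ length (fword (NestedFamily.left F k)))
             (fright-long : ∀ k → k < length (fword (NestedFamily.right F k))) where
  open NestedFamily F
  open Limit F
  open Covers

  module F′ = Limit (imageFamily F fleft-long fright-long)

  fword-word : ∀ k → F′.word k ≡ fword (word k)
  fword-word k = sym (fword-++ (left k) (right k))

  blockStart : ℕ → ℕ → ℤ
  blockStart k t = offset (word k) t ⊖ length (fword (left k))

  blockStart-stable : Stable blockStart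
  blockStart-stable {k} {k′} {t} e@(p , q , eˡ , _) t<w = begin
    offset (word k′) (length p + t) ⊖ length (fword (left k′))
      ≡⟨ cong₂ _⊖_ (trans (cong (λ w → offset w (length p + t)) (word-extends e))
                          (offset-++ p (word k) q (ℕₚ.<⇒≤ t<w)))
                   (trans (cong (length ∘ fword) eˡ) (length-fword-++ p (left k))) ⟩
    (length (fword p) + offset (word k) t) ⊖ (length (fword p) + length (fword (left k)))
      ≡⟨ +-cancelˡ-⊖ (length (fword p)) _ _ ⟩
    blockStart k t ∎

  position : ℤ → ℤ
  position = limitOf blockStart

  position-covers : ∀ {j k t} → Covers j k t → position j ≡ blockStart k t
  position-covers = limitOf-covers blockStart-stable

  position-zero : position (+ 0) ≡ + 0
  position-zero = trans (cong (_⊖ l) (offset-length (left 0) (right 0))) (n⊖n≡0 l)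
    where l = length (fword (left 0))

  position-suc : ∀ j → position (j ℤ.+ + 1) ≡ position j ℤ.+ + length (fmor (limit j))
  position-suc j = begin
    position (j ℤ.+ + 1)                                   ≡⟨ position-covers c′ ⟩
    blockStart k (suc t)                                   ≡⟨ cong (_⊖ l) (offset-suc (word k) (inside c)) ⟩
    (offset (word k) t + length (fmor (nth (word k) t))) ⊖ l  ≡⟨ distribˡ-⊖-+-pos _ _ l ⟨
    blockStart k t ℤ.+ + length (fmor (nth (word k) t))    ≡⟨ cong₂ (λ i c → i ℤ.+ + length (fmor c))
                                                                   (position-covers c) (limit-covers c) ⟨
    position j ℤ.+ + length (fmor (limit j))               ∎
    where
    k = ∣ j ∣ + ∣ j ℤ.+ + 1 ∣
    t = index j k
    l = length (fword (left k))
    c : Covers j k t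
    c = index-covers {j} (m≤m+n _ _)
    c′ : Covers (j ℤ.+ + 1) k (suc t)
    c′ = subst (Covers (j ℤ.+ + 1) k) (+-comm t 1) (covers-+ 1 c (m≤n+m _ _))

  image-occurs : ∀ j → Occurs F′.limit (position j) (fmor (limit j))
  image-occurs j i = begin
    F′.limit (position j ℤ.+ + toℕ i)     ≡⟨ F′.limit-covers c′ ⟩
    nth (F′.word k) (o + toℕ i)          ≡⟨ cong (λ w → nth w (o + toℕ i)) (fword-word k) ⟩
    nth (fword (word k)) (o + toℕ i)     ≡⟨ proj₂ block ⟩
    nth (fmor (nth (word k) t)) (toℕ i)  ≡⟨ nth-toℕ (fmor (limit j)) i ⟩
    lookup (fmor (limit j)) i            ∎
    where
    k = ∣ j ∣
    t = index j k
    o = offset (word k) t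
    l = length (fword (left k))
    block = nth-fword (word k) (inside (covers-self j)) (toℕ<n i)
    c′ : F′.Covers (position j ℤ.+ + toℕ i) k (o + toℕ i)
    c′ = F′.covering
      (sym (trans (cong (ℤ._+ + l) (distribˡ-⊖-+-pos (toℕ i) o l)) (m⊖n+n≡m (o + toℕ i) l)))
      (subst (o + toℕ i <_) (sym (cong length (fword-word k))) (proj₁ block))

  limit-image : ImageOf limit F′.limit
  limit-image = position , position-zero , position-suc , image-occurs

-- Two-sided fixed points of g = f²

g : List A → List A
g = fword ∘ fword

gpow : ℕ → List A → List A
gpow zero    w = w
gpow (suc k) w = g (gpow k w)

g-++ : ∀ u v → g (u ++ v) ≡ g u ++ g v
g-++ u v = trans (cong fword (fword-++ u v)) (fword-++ (fword u) (fword v))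

gpow-++ : ∀ k u v → gpow k (u ++ v) ≡ gpow k u ++ gpow k v
gpow-++ zero    u v = refl
gpow-++ (suc k) u v = trans (cong g (gpow-++ k u v)) (g-++ (gpow k u) (gpow k v))

gpow-g : ∀ k w → gpow k (g w) ≡ gpow (suc k) w
gpow-g zero    w = refl
gpow-g (suc k) w = cong g (gpow-g k w)

fword-gpow : ∀ k w → fword (gpow k w) ≡ gpow k (fword w)
fword-gpow zero    w = refl
fword-gpow (suc k) w = cong g (fword-gpow k w)

inLang-gpow : ∀ k {w} → InLang w → InLang (gpow k w)
inLang-gpow zero    w∈L = w∈L
inLang-gpow (suc k) w∈L = inLang-fword (inLang-fword (inLang-gpow k w∈L))

gpow-suffix : ∀ {a p} → g a ≡ p ++ a → ∀ k → gpow (suc k) a ≡ gpow k p ++ gpow k a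
gpow-suffix {a} {p} e k = trans (sym (gpow-g k a)) (trans (cong (gpow k) e) (gpow-++ k p a))

gSeries : List A → ℕ → List A
gSeries q zero    = []
gSeries q (suc k) = gSeries q k ++ gpow k q

gpow-prefix : ∀ {b q} → g b ≡ b ++ q → ∀ k → gpow k b ≡ b ++ gSeries q k
gpow-prefix {b} {q} e zero    = sym (++-identityʳ b)
gpow-prefix {b} {q} e (suc k) = begin
  gpow (suc k) b                   ≡⟨ gpow-g k b ⟨
  gpow k (g b)                     ≡⟨ cong (gpow k) e ⟩
  gpow k (b ++ q)                  ≡⟨ gpow-++ k b q ⟩
  gpow k b ++ gpow k q             ≡⟨ cong (_++ gpow k q) (gpow-prefix e k) ⟩
  (b ++ gSeries q k) ++ gpow k q   ≡⟨ ++-assoc b (gSeries q k) _ ⟩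
  b ++ gSeries q (suc k)           ∎

fword-gSeries : ∀ q k → fword (gSeries q k) ≡ gSeries (fword q) k
fword-gSeries q zero    = refl
fword-gSeries q (suc k) = trans (fword-++ (gSeries q k) _) (cong₂ _++_ (fword-gSeries q k) (fword-gpow k q))

data StartsWith01 : List A → Set where
  0∷_ : ∀ w → StartsWith01 (a0 ∷ w)
  1∷_ : ∀ w → StartsWith01 (a1 ∷ w)

startsWith01-fword : ∀ {w} → StartsWith01 w → StartsWith01 (fword w)
startsWith01-fword (0∷ w) = 0∷ _
startsWith01-fword (1∷ w) = 1∷ _

startsWith01-gpow : ∀ k {w} → StartsWith01 w → StartsWith01 (gpow k w)
startsWith01-gpow zero    s = s
startsWith01-gpow (suc k) s = startsWith01-fword (startsWith01-fword (startsWith01-gpow k s))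

startsWith01-nonempty : ∀ {w} → StartsWith01 w → 1 ≤ length w
startsWith01-nonempty (0∷ w) = s≤s z≤n
startsWith01-nonempty (1∷ w) = s≤s z≤n

gpow-long : ∀ {a p} → g a ≡ p ++ a → StartsWith01 p → ∀ k → k ≤ length (gpow k a)
gpow-long e s zero    = z≤n
gpow-long {a} {p} e s (suc k) =
  subst (suc k ≤_) (sym (trans (cong length (gpow-suffix e k)) (length-++ (gpow k p))))
    (+-mono-≤ (startsWith01-nonempty (startsWith01-gpow k s)) (gpow-long e s k))

gSeries-long : ∀ {q} → StartsWith01 q → ∀ k → k ≤ length (gSeries q k)
gSeries-long s zero    = z≤n
gSeries-long {q} s (suc k) =
  subst₂ _≤_ (+-comm k 1) (sym (length-++ (gSeries q k)))
    (+-mono-≤ (gSeries-long s k) (startsWith01-nonempty (startsWith01-gpow k s)))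

left-long : ∀ {a p} → g a ≡ p ++ a → StartsWith01 p → ∀ w k → k ≤ length (gpow k a ++ w)
left-long {a} e s w k = ≤-trans (gpow-long e s k) (length-++-≤ˡ (gpow k a))

right-long : ∀ {c q} → StartsWith01 c → StartsWith01 q → ∀ k → k < length (c ++ gSeries q k)
right-long {c} sc sq k = subst (suc k ≤_) (sym (length-++ c))
  (+-mono-≤ (startsWith01-nonempty sc) (gSeries-long sq k))

record Seed : Set where
  field
    α β p q       : List A
    α-suffix      : g α ≡ p ++ α
    β-prefix      : g β ≡ β ++ q
    p-starts      : StartsWith01 p
    q-starts      : StartsWith01 q
    cut           : ℕ
    centre-starts : StartsWith01 (drop cut β)
    αβ-inLang     : InLang (α ++ β)

-- The limit of g^k(α) · g^k(β), centred cut letters into β.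
module FixedPoint (S : Seed) where
  open Seed S

  family : NestedFamily
  family = record
    { left        = λ k → gpow k α ++ take cut β
    ; right       = λ k → drop cut β ++ gSeries q k
    ; left-grows  = λ k → gpow k p ,
        trans (cong (_++ take cut β) (gpow-suffix α-suffix k)) (++-assoc (gpow k p) _ _)
    ; right-grows = λ k → gpow k q , sym (++-assoc (drop cut β) (gSeries q k) _)
    ; left-long   = left-long α-suffix p-starts (take cut β)
    ; right-long  = right-long centre-starts q-starts
    }

  fleft-long : ∀ k → k ≤ length (fword (gpow k α ++ take cut β))
  fleft-long k = subst (k ≤_) (cong length (sym eq))
    (left-long (trans (cong fword α-suffix) (fword-++ p α)) (startsWith01-fword p-starts) _ k)
    where
    eq : fword (gpow k α ++ take cut β) ≡ gpow k (fword α) ++ fword (take cut β)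
    eq = trans (fword-++ (gpow k α) _) (cong (_++ _) (fword-gpow k α))

  fright-long : ∀ k → k < length (fword (drop cut β ++ gSeries q k))
  fright-long k = subst (k <_) (cong length (sym eq))
    (right-long (startsWith01-fword centre-starts) (startsWith01-fword q-starts) k)
    where
    eq : fword (drop cut β ++ gSeries q k) ≡ fword (drop cut β) ++ gSeries (fword q) k
    eq = trans (fword-++ (drop cut β) _) (cong (_ ++_) (fword-gSeries q k))

  word-gpow : ∀ k → Limit.word family k ≡ gpow k (α ++ β)
  word-gpow k = begin
    (gpow k α ++ take cut β) ++ drop cut β ++ gSeries q k  ≡⟨ ++-assoc (gpow k α) _ _ ⟩
    gpow k α ++ take cut β ++ drop cut β ++ gSeries q k    ≡⟨ cong (gpow k α ++_) (++-assoc (take cut β) _ _) ⟨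
    gpow k α ++ (take cut β ++ drop cut β) ++ gSeries q k  ≡⟨ cong (λ b → gpow k α ++ b ++ gSeries q k)
                                                                   (take++drop≡id cut β) ⟩
    gpow k α ++ β ++ gSeries q k                           ≡⟨ cong (gpow k α ++_) (gpow-prefix β-prefix k) ⟨
    gpow k α ++ gpow k β                                   ≡⟨ gpow-++ k α β ⟨
    gpow k (α ++ β)                                        ∎

  x y : Seq
  x = Limit.limit family
  y = Limit.limit (imageFamily family fleft-long fright-long)

  x-inX : InX x
  x-inX = Limit.limit-inX family λ k → subst InLang (sym (word-gpow k)) (inLang-gpow k αβ-inLang)

  x-image : ImageOf x y
  x-image = Image.limit-image family fleft-long fright-long

centred-at-1 : Seed
centred-at-1 = record
  { α = a1 ∷ a2 ∷ [] ; β = a1 ∷ [] ; p = take 16 (g (a1 ∷ a2 ∷ [])) ; q = drop 1 (g (a1 ∷ []))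
  ; α-suffix = refl ; β-prefix = refl ; p-starts = 1∷ _ ; q-starts = 1∷ _
  ; cut = 0 ; centre-starts = 1∷ _
  ; αβ-inLang = 2 , a0 , a0 ∷ [] , a1 ∷ a2 ∷ a0 ∷ a0 ∷ a2 ∷ [] , refl
  }

centred-at-00 : Seed
centred-at-00 = record
  { α = a1 ∷ a2 ∷ [] ; β = g (a0 ∷ []) ; p = take 16 (g (a1 ∷ a2 ∷ [])) ; q = drop 9 (g (g (a0 ∷ [])))
  ; α-suffix = refl ; β-prefix = refl ; p-starts = 1∷ _ ; q-starts = 1∷ _
  ; cut = 6 ; centre-starts = 0∷ _
  ; αβ-inLang = 3 , a1 , take 13 (fpow 3 (a1 ∷ [])) , drop 24 (fpow 3 (a1 ∷ [])) , refl
  }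

-- Non-recognizability for n ≤ 1

module ImagePoint {x y : Seq} (x-inX : InX x) (x-image : ImageOf x y) where

  shifted : ℕ → Seq
  shifted j i = y (i ℤ.+ + j)

  shifted-inY : ∀ j → InY (shifted j)
  shifted-inY j _ = x , y , + j , x-inX , x-image , λ _ _ → refl

  factorOfY : ∀ j p w → Occurs (shifted j) p w → FactorOfY w
  factorOfY j p w occ = shifted j , p , shifted-inY j , occ

  hits : ∀ u v j → Occurs (shifted j) (- + length u) (u ++ v) → Hits u v (x (+ 0)) j
  hits u v j occ = shifted j , (shifted-inY j , occ) , x , y , x-inX , refl , x-image , λ _ → refl

module At1  = FixedPoint centred-at-1
module At00 = FixedPoint centred-at-00
module Y₁  = ImagePoint {At1.x} {At1.y} At1.x-inX At1.x-image
module Y₀₀ = ImagePoint {At00.x} {At00.y} At00.x-inX At00.x-image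

-- Shifted by 2, f(x) with x₀ = 1 and f(x′) with x′₀x′₁ = 00 read 11·200 and 01·201 around the
-- origin, with cuts (1 , 2) and (0 , 2); the two windows agree on 1·20.
ambiguous-window : ∀ {n} u v → length u ≡ n → length v ≡ suc n →
  Occurs (Y₁.shifted 2) (- + length u) u → Occurs (Y₁.shifted 2) (+ 0) v →
  Occurs (Y₁.shifted 2) (- + length u) (u ++ v) → Occurs (Y₀₀.shifted 2) (- + length u) (u ++ v) →
  ¬ Recognizable n
ambiguous-window u v |u| |v| u∈z v∈z uv∈z uv∈z′ R =
  case proj₁ (R u v |u| |v| (Y₁.factorOfY 2 (- + length u) u u∈z) (Y₁.factorOfY 2 (+ 0) v v∈z)
                (Y₁.factorOfY 2 (- + length u) (u ++ v) uv∈z)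
                a1 a0 2 2 (s≤s (s≤s (s≤s z≤n))) (s≤s (s≤s (s≤s z≤n)))
                (Y₁.hits u v 2 uv∈z) (Y₀₀.hits u v 2 uv∈z′)) of λ ()

¬recognizable-0 : ¬ Recognizable 0
¬recognizable-0 = ambiguous-window [] (a2 ∷ []) refl refl
  (λ ())
  (λ { f0 → refl })
  (λ { f0 → refl })
  (λ { f0 → refl })

¬recognizable-1 : ¬ Recognizable 1
¬recognizable-1 = ambiguous-window (a1 ∷ []) (a2 ∷ a0 ∷ []) refl refl
  (λ { f0 → refl })
  (λ { f0 → refl ; (fs f0) → refl })
  (λ { f0 → refl ; (fs f0) → refl ; (fs (fs f0)) → refl })
  (λ { f0 → refl ; (fs f0) → refl ; (fs (fs f0)) → refl })

-- Recognizability with constant 2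

-- Cut (b , j) puts letter i of f(b) under position m of a window centred at s iff m + j = s + i.
Compatible : ℕ → ℕ → A → ℕ → A → ℕ → Set
Compatible n s b j b′ j′ = (m : Fin n) (i : Fin (length (fmor b))) (i′ : Fin (length (fmor b′))) →
  toℕ m + j ≡ s + toℕ i → toℕ m + j′ ≡ s + toℕ i′ → lookup (fmor b) i ≡ lookup (fmor b′) i′

compatible? : ∀ n s b j b′ j′ → Dec (Compatible n s b j b′ j′)
compatible? n s b j b′ j′ = all? λ m → all? λ i → all? λ i′ →
  (toℕ m + j ℕₚ.≟ s + toℕ i) →-dec (toℕ m + j′ ℕₚ.≟ s + toℕ i′) →-dec
  (lookup (fmor b) i Fin.≟ lookup (fmor b′) i′)

window-index : ∀ l m j i → m + j ≡ l + i → - + l ℤ.+ + m ℤ.+ + j ≡ + i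
window-index l m j i e = begin
  - + l ℤ.+ + m ℤ.+ + j      ≡⟨ ℤₚ.+-assoc (- + l) (+ m) (+ j) ⟩
  - + l ℤ.+ (+ m ℤ.+ + j)    ≡⟨ cong (ℤ._+_ (- + l)) (pos-+ m j) ⟨
  - + l ℤ.+ + (m + j)        ≡⟨ -m+n≡n⊖m l (m + j) ⟩
  (m + j) ⊖ l                ≡⟨ cong (_⊖ l) (trans e (+-comm l i)) ⟩
  (i + l) ⊖ l                ≡⟨ m+n⊖n≡m i l ⟩
  + i                        ∎

hits-aligned : ∀ {u v b j} → Hits u v b j →
  (m : Fin (length (u ++ v))) (i : Fin (length (fmor b))) → toℕ m + j ≡ length u + toℕ i →
  lookup (u ++ v) m ≡ lookup (fmor b) i
hits-aligned {u} {v} {j = j} (z , (_ , uv∈z) , x , y , _ , refl , (pos , pos₀ , _ , fx∈y) , z≡y) m i e = begin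
  lookup (u ++ v) m                            ≡⟨ uv∈z m ⟨
  z (- + length u ℤ.+ + toℕ m)                 ≡⟨ z≡y _ ⟩
  y (- + length u ℤ.+ + toℕ m ℤ.+ + j)         ≡⟨ cong y (window-index (length u) (toℕ m) j (toℕ i) e) ⟩
  y (+ toℕ i)                                  ≡⟨ cong (λ p → y (p ℤ.+ + toℕ i)) pos₀ ⟨
  y (pos (+ 0) ℤ.+ + toℕ i)                    ≡⟨ fx∈y (+ 0) i ⟩
  lookup (fmor (x (+ 0))) i                    ∎

hits-compatible : ∀ {u v b b′ j j′} → Hits u v b j → Hits u v b′ j′ →
  Compatible (length (u ++ v)) (length u) b j b′ j′
hits-compatible {u} {v} h h′ m i i′ e e′ =
  trans (sym (hits-aligned {u} {v} h m i e)) (hits-aligned {u} {v} h′ m i′ e′)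

compatible⇒same-cut : ∀ b (j : Fin (length (fmor b))) b′ (j′ : Fin (length (fmor b′))) →
  Compatible 5 2 b (toℕ j) b′ (toℕ j′) → b ≡ b′ × toℕ j ≡ toℕ j′
compatible⇒same-cut = toWitness {a? = all? λ b → all? λ j → all? λ b′ → all? λ j′ →
  compatible? 5 2 b (toℕ j) b′ (toℕ j′) →-dec (b Fin.≟ b′ ×-dec toℕ j ℕₚ.≟ toℕ j′)} _

compatible⇒same-cut′ : ∀ {b b′ j j′} → j < length (fmor b) → j′ < length (fmor b′) →
  Compatible 5 2 b j b′ j′ → b ≡ b′ × j ≡ j′
compatible⇒same-cut′ {b} {b′} j< j′< c =
  let b≡b′ , j≡j′ = compatible⇒same-cut b (fromℕ< j<) b′ (fromℕ< j′<)
                      (subst₂ (λ i i′ → Compatible 5 2 b i b′ i′)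
                              (sym (toℕ-fromℕ< j<)) (sym (toℕ-fromℕ< j′<)) c)
  in b≡b′ , trans (sym (toℕ-fromℕ< j<)) (trans j≡j′ (toℕ-fromℕ< j′<))

recognizable-2 : Recognizable 2
recognizable-2 u v |u|≡2 |v|≡3 _ _ _ b b′ j j′ j< j′< h h′ =
  compatible⇒same-cut′ j< j′<
    (subst₂ (λ n s → Compatible n s b j b′ j′) |uv|≡5 |u|≡2 (hits-compatible {u} {v} h h′))
  where
  |uv|≡5 : length (u ++ v) ≡ 5
  |uv|≡5 = trans (length-++ u) (cong₂ _+_ |u|≡2 |v|≡3)

lemma20 : Recognizable 2 × ((n : ℕ) → n < 2 → ¬ Recognizable n)
lemma20 = recognizable-2 , λ { 0 _ → ¬recognizable-0 ; 1 _ → ¬recognizable-1 ; (suc (suc n)) (s≤s (s≤s ())) }
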